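{- Let $\mathscr{M}$ be a minion of rank at most $r$, and let $h\ge r$. Then $\mathscr{M}^{(h)}$ is isomorphic to $\mathrm{Pol}(\mathbf{K}^h_r,\mathbf{F})$, where $\mathbf{F}=\mathbf{F}_\mathscr{M}(\mathbf{K}^h_r)$.
   Context: Minions: disjoint sets $\mathscr{M}(n)$, $n\in\mathbb{N}$, with maps $f\mapsto f^\pi\in\mathscr{M}(m)$ for $\pi:[n]\to[m]$, $f^{\mathrm{id}}=f$, $f^{\pi_1\circ\pi_2}=(f^{\pi_2})^{\pi_1}$; isomorphism = bijective homomorphism (arity- and minoring-preserving). $\mathrm{Pol}(\mathbf{A},\mathbf{B})$: $n$-ary elements are homomorphisms $\mathbf{A}^n\to\mathbf{B}$, $f^\pi(\mathbf{b})=f(\mathbf{b}\circ\pi)$ ($\mathbf{b}\in A^m$ viewed as a map $[m]\to A$). Rank: the least $r$ such that any two $f_1,f_2\in\mathscr{M}(n)$ (any $n$) with $f_1^\pi=f_2^\pi$ for all $\pi\in[r]^{[n]}$ are equal. $h$-dimensional closure $\mathscr{M}^{(h)}$: an $m$-ary system of $h$-ary minors is a map $\zeta:[h]^{[m]}\to\mathscr{M}(h)$ such that $\zeta(\pi_2)^\sigma=\zeta(\pi_1)$ whenever $\pi_1=\sigma\circ\pi_2$ with $\pi_1,\pi_2\in[h]^{[m]}$, $\sigma\in[h]^{[h]}$. $\mathscr{M}^{(h)}(m)$ is the set of $m$-ary systems, and for $\sigma:[m]\to[n]$, $\zeta^\sigma$ is the $n$-ary system $\pi\mapsto\zeta(\pi\circ\sigma)$.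 $\mathbf{K}^h_r$ ($h\ge r$): one relation symbol $R$ of arity $m=r^h$; with $\pi_1,\dots,\pi_m$ the lexicographic enumeration of $[r]^{[h]}$, universe $[r]$ and $R=\{(\pi_1(i),\dots,\pi_m(i)):i\in[h]\}$. Free structure $\mathbf{F}_\mathscr{M}(\mathbf{A})$: identify $A$ with $[n]$ and each $R^A$ with $[m_R]$ by fixed bijections; universe $\mathscr{M}(n)$, and $(f_1,\dots,f_{\mathrm{ar}(R)})\in R^F$ iff there is $g\in\mathscr{M}(m_R)$ with $g^{\rho_i}=f_i$ for all $i$, where $\rho_i:[m_R]\to[n]$ sends a tuple $t\in R^A$ to its $i$-th entry. -}

module Defs where

open import Data.Nat using (ℕ; zero; suc; _≤_; _^_)
open import Data.Fin using (Fin; remQuot)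
import Data.Fin as Fin
open import Data.Product using (Σ; _×_; _,_; ∃; proj₁; proj₂)
open import Function using (id; _∘_)
open import Relation.Binary using (IsEquivalence)
open import Relation.Binary.PropositionalEquality as P using (_≡_; _≗_; refl)

-- Minions.  M n is the set of n-ary elements; sets are rendered as
-- setoids (carrier + equivalence _≈_).  A map π : [n] → [m] is a
-- function Fin n → Fin m, and minor π f is f^π.

record Minion : Set₁ where
  field
    M        : ℕ → Set
    _≈_      : ∀ {n} → M n → M n → Set
    ≈-equiv  : ∀ {n} → IsEquivalence (_≈_ {n})
    minor    : ∀ {n m} → (Fin n → Fin m) → M n → M m
    -- f^π depends only on the graph of π (functions are extensional)
    minor-cong : ∀ {n m} {π π′ : Fin n → Fin m} {f g : M n} →
                 π ≗ π′ → f ≈ g → minor π f ≈ minor π′ g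
    minor-id : ∀ {n} (f : M n) → minor id f ≈ f
    minor-∘  : ∀ {n m k} (π₁ : Fin m → Fin k) (π₂ : Fin n → Fin m) (f : M n) →
               minor (π₁ ∘ π₂) f ≈ minor π₁ (minor π₂ f)

open Minion

record Hom (𝓜 𝓝 : Minion) : Set where
  field
    map       : ∀ {n} → M 𝓜 n → M 𝓝 n
    map-cong  : ∀ {n} {f g : M 𝓜 n} → _≈_ 𝓜 f g → _≈_ 𝓝 (map f) (map g)
    map-minor : ∀ {n m} (π : Fin n → Fin m) (f : M 𝓜 n) →
                _≈_ 𝓝 (map (minor 𝓜 π f)) (minor 𝓝 π (map f))

record _≅_ (𝓜 𝓝 : Minion) : Set where
  field
    hom        : Hom 𝓜 𝓝
    injective  : ∀ {n} (f g : M 𝓜 n) →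
                 _≈_ 𝓝 (Hom.map hom f) (Hom.map hom g) → _≈_ 𝓜 f g
    surjective : ∀ {n} (y : M 𝓝 n) → Σ (M 𝓜 n) λ x → _≈_ 𝓝 (Hom.map hom x) y

RankProperty : Minion → ℕ → Set
RankProperty 𝓜 r = ∀ {n} (f₁ f₂ : M 𝓜 n) →
  (∀ (π : Fin n → Fin r) → _≈_ 𝓜 (minor 𝓜 π f₁) (minor 𝓜 π f₂)) →
  _≈_ 𝓜 f₁ f₂

-- "rank at most r": the least r′ with the property exists and is ≤ r,
-- i.e. some r′ ≤ r has the property.
RankAtMost : Minion → ℕ → Set
RankAtMost 𝓜 r = Σ ℕ λ r′ → r′ ≤ r × RankProperty 𝓜 r′

record System (𝓜 : Minion) (h m : ℕ) : Set where
  field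
    ζ      : (Fin m → Fin h) → M 𝓜 h
    compat : ∀ (π₁ π₂ : Fin m → Fin h) (σ : Fin h → Fin h) →
             π₁ ≗ σ ∘ π₂ → _≈_ 𝓜 (minor 𝓜 σ (ζ π₂)) (ζ π₁)

module _ (𝓜 : Minion) (h : ℕ) where
  private
    module E {n} = IsEquivalence (≈-equiv 𝓜 {n})

  System-≈ : ∀ {m} → System 𝓜 h m → System 𝓜 h m → Set
  System-≈ ζ₁ ζ₂ = ∀ π → _≈_ 𝓜 (System.ζ ζ₁ π) (System.ζ ζ₂ π)

  System-minor : ∀ {m n} → (Fin m → Fin n) → System 𝓜 h m → System 𝓜 h n
  System-minor σ z = record
    { ζ      = λ π → System.ζ z (π ∘ σ)
    ; compat = λ π₁ π₂ τ e → System.compat z (π₁ ∘ σ) (π₂ ∘ σ) τ (λ x → e (σ x))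
    }

  Closure : Minion
  Closure = record
    { M = System 𝓜 h
    ; _≈_ = System-≈
    ; ≈-equiv = record
        { refl  = λ π → E.refl
        ; sym   = λ e π → E.sym (e π)
        ; trans = λ e₁ e₂ π → E.trans (e₁ π) (e₂ π)
        }
    ; minor = System-minor
    ; minor-cong = λ {n} {m} {σ} {σ′} {z₁} {z₂} eσ ez π →
        E.trans (E.trans (E.sym (minor-id 𝓜 (System.ζ z₁ (π ∘ σ))))
                         (System.compat z₁ (π ∘ σ′) (π ∘ σ) id (λ x → P.cong π (P.sym (eσ x)))))
                (ez (π ∘ σ′))
    ; minor-id = λ f π → E.refl
    ; minor-∘ = λ π₁ π₂ f π → E.refl
    }

record Structure (k : ℕ) : Set₁ where
  field
    U       : Set
    _≈U_    : U → U → Set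
    ≈U-equiv : IsEquivalence _≈U_
    R       : (Fin k → U) → Set

open Structure

-- n-ary polymorphism: homomorphism A^n → B.  An element of A^n is a map
-- Fin n → U A; (a₁,…,a_k) ∈ R^(A^n) iff every coordinate tuple is in R^A.
record PolElem {k} (A B : Structure k) (n : ℕ) : Set where
  field
    fun      : (Fin n → U A) → U B
    fun-cong : ∀ {a b : Fin n → U A} → (∀ l → _≈U_ A (a l) (b l)) →
               _≈U_ B (fun a) (fun b)
    fun-hom  : ∀ (t : Fin k → Fin n → U A) → (∀ l → R A (λ i → t i l)) →
               R B (λ i → fun (t i))

module _ {k} (A B : Structure k) where
  private
    module EA = IsEquivalence (≈U-equiv A)
    module EB = IsEquivalence (≈U-equiv B)

  Pol-minor : ∀ {n m} → (Fin n → Fin m) → PolElem A B n → PolElem A B m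
  Pol-minor π f = record
    { fun      = λ b → PolElem.fun f (b ∘ π)
    ; fun-cong = λ e → PolElem.fun-cong f (λ l → e (π l))
    ; fun-hom  = λ t H → PolElem.fun-hom f (λ i → t i ∘ π) (λ l → H (π l))
    }

  Pol : Minion
  Pol = record
    { M = PolElem A B
    ; _≈_ = λ f g → ∀ b → _≈U_ B (PolElem.fun f b) (PolElem.fun g b)
    ; ≈-equiv = record
        { refl  = λ b → EB.refl
        ; sym   = λ e b → EB.sym (e b)
        ; trans = λ e₁ e₂ b → EB.trans (e₁ b) (e₂ b)
        }
    ; minor = Pol-minor
    ; minor-cong = λ {n} {m} {π} {π′} {f} {g} eπ efg b →
        EB.trans (PolElem.fun-cong f (λ l → EA.reflexive (P.cong b (eπ l))))
                 (efg (b ∘ π′))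
    ; minor-id = λ f b → EB.refl
    ; minor-∘ = λ π₁ π₂ f b → EB.refl
    }

-- lexicographic enumeration π₀, π₁, … of [r]^[h] (words π(0)…π(h-1),
-- the first letter most significant)
lex : ∀ {r} h → Fin (r ^ h) → Fin h → Fin r
lex {r} (suc h) j Fin.zero    = proj₁ (remQuot {r} (r ^ h) j)
lex {r} (suc h) j (Fin.suc i) = lex h (proj₂ (remQuot {r} (r ^ h) j)) i

KRel : ∀ r h → (Fin (r ^ h) → Fin r) → Set
KRel r h t = ∃ λ (i : Fin h) → ∀ j → t j ≡ lex h j i

K : ∀ r h → Structure (r ^ h)
K r h = record
  { U = Fin r
  ; _≈U_ = _≡_
  ; ≈U-equiv = P.isEquivalence
  ; R = KRel r h
  }

-- Free structure F_𝓜(A) for a structure A with universe [n] and one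
-- relation R^A ⊆ [n]^k, whose relation is identified with [m_R] by the
-- enumeration enum : [m_R] → R^A (required to be a bijection, below).

IsEnumeration : ∀ {n k} (RA : (Fin k → Fin n) → Set) {mR : ℕ} →
                (Fin mR → Fin k → Fin n) → Set
IsEnumeration RA {mR} enum =
  (∀ t → RA (enum t)) ×
  (∀ x → RA x → Σ (Fin mR) λ t → enum t ≗ x) ×
  (∀ t t′ → enum t ≗ enum t′ → t ≡ t′)

Free : (𝓜 : Minion) {n k mR : ℕ} → (Fin mR → Fin k → Fin n) → Structure k
Free 𝓜 {n} {k} {mR} enum = record
  { U = M 𝓜 n
  ; _≈U_ = _≈_ 𝓜
  ; ≈U-equiv = ≈-equiv 𝓜
  ; R = λ f → Σ (M 𝓜 mR) λ g → ∀ i → _≈_ 𝓜 (minor 𝓜 (λ t → enum t i) g) (f i)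
  }

-- Since 𝓜 has rank at most r ≤ h, an h-ary element is determined by its minors along
-- maps σ : [h] → [r], and for a system ζ these are ζ(π)^σ = ζ(σ ∘ π). So ζ is determined
-- by its values on maps into [r] ⊆ [h], i.e. by a function f : [r]^n → 𝓜(r). This f is a
-- polymorphism K^h_r → F: the columns of a tuple of (R^K)^n are R^K-tuples, i.e. rows
-- lex(τ(1)), …, lex(τ(n)) of the lexicographic enumeration, and a minor of ζ(τ) witnesses
-- membership in R^F. Conversely, a polymorphism f yields the system π ↦ g_π^index, where
-- g_π ∈ 𝓜(m_R) witnesses that f maps the rows lex(π(1)), …, lex(π(n)) into R^F; its minor
-- along σ is f(σ ∘ π), so compatibility again follows from the rank bound.
module Submission where

open import Defs
open import Data.Nat using (ℕ; zero; suc; _≤_; _^_; s≤s; z≤n)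
open import Data.Fin using (Fin; inject≤; finToFun; funToFin)
import Data.Fin as Fin
open import Data.Fin.Properties using (¬Fin0; finToFun-funToFin)
open import Data.Product using (_,_; proj₁; proj₂)
open import Function using (id; _∘_)
open import Relation.Binary using (Setoid; IsEquivalence)
open import Relation.Binary.PropositionalEquality using (_≡_; _≗_; refl; sym; trans; cong)
open import Relation.Nullary using (contradiction)
import Relation.Binary.Reasoning.Setoid as SetoidReasoning

open Minion

clamp : ∀ {a b} → Fin b → Fin (suc a)
clamp {zero}  _           = Fin.zero
clamp {suc a} Fin.zero    = Fin.zero
clamp {suc a} (Fin.suc i) = Fin.suc (clamp i)

clamp-inject≤ : ∀ {a b} (i : Fin (suc a)) (a<b : suc a ≤ b) → clamp (inject≤ i a<b) ≡ i
clamp-inject≤ {zero}  Fin.zero    (s≤s _)   = refl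
clamp-inject≤ {suc a} Fin.zero    (s≤s _)   = refl
clamp-inject≤ {suc a} (Fin.suc i) (s≤s a<b) = cong Fin.suc (clamp-inject≤ i a<b)

lex≗finToFun : ∀ {r} h (j : Fin (r ^ h)) → lex h j ≗ finToFun j
lex≗finToFun (suc h) j Fin.zero    = refl
lex≗finToFun (suc h) j (Fin.suc i) = lex≗finToFun h _ i

lex-funToFin : ∀ {r} h (σ : Fin h → Fin r) → lex h (funToFin σ) ≗ σ
lex-funToFin h σ i = trans (lex≗finToFun h (funToFin σ) i) (finToFun-funToFin σ i)

module MinionProperties (𝓜 : Minion) where

  setoid : ℕ → Setoid _ _
  setoid n = record { isEquivalence = ≈-equiv 𝓜 {n} }

  module _ {n : ℕ} where
    open IsEquivalence (≈-equiv 𝓜 {n}) public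
      using () renaming (refl to ≈-refl; sym to ≈-sym; trans to ≈-trans)

  minor-congˡ : ∀ {n m} {π π′ : Fin n → Fin m} (f : M 𝓜 n) →
                π ≗ π′ → _≈_ 𝓜 (minor 𝓜 π f) (minor 𝓜 π′ f)
  minor-congˡ f π≗π′ = minor-cong 𝓜 π≗π′ ≈-refl

  minor-congʳ : ∀ {n m} (π : Fin n → Fin m) {f g : M 𝓜 n} →
                _≈_ 𝓜 f g → _≈_ 𝓜 (minor 𝓜 π f) (minor 𝓜 π g)
  minor-congʳ π = minor-cong 𝓜 (λ _ → refl)

  minor-factor : ∀ {n a b} (ι : Fin a → Fin b) (ρ : Fin b → Fin a) → ρ ∘ ι ≗ id →
                 (σ : Fin n → Fin a) (f : M 𝓜 n) →
                 _≈_ 𝓜 (minor 𝓜 σ f) (minor 𝓜 ρ (minor 𝓜 (ι ∘ σ) f))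
  minor-factor ι ρ ρι σ f = ≈-trans (minor-congˡ f (λ i → sym (ρι (σ i))))
                                    (minor-∘ 𝓜 ρ (ι ∘ σ) f)

  Separates : ℕ → ℕ → Set
  Separates r n = (f₁ f₂ : M 𝓜 n) →
    (∀ (π : Fin n → Fin r) → _≈_ 𝓜 (minor 𝓜 π f₁) (minor 𝓜 π f₂)) → _≈_ 𝓜 f₁ f₂

  -- Fin n is needed: for nullary elements rank 0 does not imply rank r.
  separates-mono : ∀ {r′ r n} → r′ ≤ r → Fin n → Separates r′ n → Separates r n
  separates-mono {zero}   _   x sep f₁ f₂ _   = sep f₁ f₂ λ π → contradiction (π x) ¬Fin0
  separates-mono {suc r′} r′≤r _ sep f₁ f₂ hyp = sep f₁ f₂ λ π → begin
    minor 𝓜 π f₁                                ≈⟨ minor-factor ι clamp ρι π f₁ ⟩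
    minor 𝓜 clamp (minor 𝓜 (ι ∘ π) f₁)         ≈⟨ minor-congʳ clamp (hyp (ι ∘ π)) ⟩
    minor 𝓜 clamp (minor 𝓜 (ι ∘ π) f₂)         ≈⟨ minor-factor ι clamp ρι π f₂ ⟨
    minor 𝓜 π f₂                                ∎
    where
      open SetoidReasoning (setoid _)
      ι : Fin (suc r′) → Fin _
      ι i = inject≤ i r′≤r
      ρι : clamp ∘ ι ≗ id
      ρι i = clamp-inject≤ i r′≤r

  rankAtMost⇒separates : ∀ {r n} → RankAtMost 𝓜 r → Fin n → Separates r n
  rankAtMost⇒separates (r′ , r′≤r , rank) x = separates-mono r′≤r x rank

module SystemProperties {𝓜 : Minion} {h n : ℕ} (z : System 𝓜 h n) where
  open System z
  open MinionProperties 𝓜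

  ζ-cong : ∀ {π π′} → π ≗ π′ → _≈_ 𝓜 (ζ π) (ζ π′)
  ζ-cong {π} {π′} π≗π′ = ≈-trans (≈-sym (minor-id 𝓜 (ζ π)))
                                 (compat π′ π id (λ x → sym (π≗π′ x)))

  minor-ζ : ∀ τ π → _≈_ 𝓜 (minor 𝓜 τ (ζ π)) (ζ (τ ∘ π))
  minor-ζ τ π = compat (τ ∘ π) π τ (λ _ → refl)

module ClosureAsPolymorphisms
  (𝓜 : Minion) {r h : ℕ}
  (ι : Fin r → Fin h) (ρ : Fin h → Fin r) (ρι : ρ ∘ ι ≗ id)
  (separates : MinionProperties.Separates 𝓜 r h)
  {mR : ℕ} {enum : Fin mR → Fin (r ^ h) → Fin r} (isEnum : IsEnumeration (KRel r h) enum)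
  where

  open MinionProperties 𝓜
  open SetoidReasoning (setoid r)

  K-tuple : Fin h → Fin (r ^ h) → Fin r
  K-tuple i j = lex h j i

  index : Fin mR → Fin h
  index s = proj₁ (proj₁ isEnum s)

  enum-index : ∀ s → enum s ≗ K-tuple (index s)
  enum-index s = proj₂ (proj₁ isEnum s)

  position : Fin h → Fin mR
  position i = proj₁ (proj₁ (proj₂ isEnum) (K-tuple i) (i , λ _ → refl))

  enum-position : ∀ i → enum (position i) ≗ K-tuple i
  enum-position i = proj₂ (proj₁ (proj₂ isEnum) (K-tuple i) (i , λ _ → refl))

  module ToPol {n} (z : System 𝓜 h n) where
    open System z
    open SystemProperties z

    fun : (Fin n → Fin r) → M 𝓜 r
    fun b = minor 𝓜 ρ (ζ (ι ∘ b))

    minor-ζ≈fun : ∀ (σ : Fin h → Fin r) π → _≈_ 𝓜 (minor 𝓜 σ (ζ π)) (fun (σ ∘ π))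
    minor-ζ≈fun σ π = ≈-trans (minor-factor ι ρ ρι σ (ζ π)) (minor-congʳ ρ (minor-ζ (ι ∘ σ) π))

    fun-hom : ∀ (t : Fin (r ^ h) → Fin n → Fin r) → (∀ l → KRel r h (λ j → t j l)) →
              Structure.R (Free 𝓜 enum) (λ j → fun (t j))
    fun-hom t t∈K = minor 𝓜 position (ζ τ) , λ j → begin
      minor 𝓜 (λ s → enum s j) (minor 𝓜 position (ζ τ))  ≈⟨ minor-∘ 𝓜 _ position (ζ τ) ⟨
      minor 𝓜 (λ i → enum (position i) j) (ζ τ)          ≈⟨ minor-congˡ (ζ τ) (λ i → enum-position i j) ⟩
      minor 𝓜 (lex h j) (ζ τ)                            ≈⟨ minor-ζ≈fun (lex h j) τ ⟩
      fun (lex h j ∘ τ)                                   ≈⟨ minor-congʳ ρ (ζ-cong (λ l → cong ι (proj₂ (t∈K l) j))) ⟨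
      fun (t j)                                           ∎
      where
        τ : Fin n → Fin h
        τ l = proj₁ (t∈K l)

    polymorphism : PolElem (K r h) (Free 𝓜 enum) n
    polymorphism = record
      { fun      = fun
      ; fun-cong = λ b≡b′ → minor-congʳ ρ (ζ-cong (λ l → cong ι (b≡b′ l)))
      ; fun-hom  = fun-hom
      }

  toPol : Hom (Closure 𝓜 h) (Pol (K r h) (Free 𝓜 enum))
  toPol = record
    { map       = ToPol.polymorphism
    ; map-cong  = λ z₁≈z₂ b → minor-congʳ ρ (z₁≈z₂ (ι ∘ b))
    ; map-minor = λ _ _ _ → ≈-refl
    }

  toPol-injective : ∀ {n} (z₁ z₂ : System 𝓜 h n) →
                    (∀ b → _≈_ 𝓜 (ToPol.fun z₁ b) (ToPol.fun z₂ b)) → System-≈ 𝓜 h z₁ z₂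
  toPol-injective z₁ z₂ fun₁≈fun₂ π = separates _ _ λ σ → begin
    minor 𝓜 σ (System.ζ z₁ π)  ≈⟨ ToPol.minor-ζ≈fun z₁ σ π ⟩
    ToPol.fun z₁ (σ ∘ π)        ≈⟨ fun₁≈fun₂ (σ ∘ π) ⟩
    ToPol.fun z₂ (σ ∘ π)        ≈⟨ ToPol.minor-ζ≈fun z₂ σ π ⟨
    minor 𝓜 σ (System.ζ z₂ π)  ∎

  module FromPol {n} (f : PolElem (K r h) (Free 𝓜 enum) n) where
    open PolElem f

    witness : (π : Fin n → Fin h) →
              Structure.R (Free 𝓜 enum) (λ j → fun (lex h j ∘ π))
    witness π = fun-hom (λ j → lex h j ∘ π) (λ l → π l , λ _ → refl)

    ζ : (Fin n → Fin h) → M 𝓜 h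
    ζ π = minor 𝓜 index (proj₁ (witness π))

    minor-ζ≈fun : ∀ (σ : Fin h → Fin r) π → _≈_ 𝓜 (minor 𝓜 σ (ζ π)) (fun (σ ∘ π))
    minor-ζ≈fun σ π = begin
      minor 𝓜 σ (minor 𝓜 index g)      ≈⟨ minor-∘ 𝓜 σ index g ⟨
      minor 𝓜 (σ ∘ index) g            ≈⟨ minor-congˡ g enum≗σ ⟨
      minor 𝓜 (λ s → enum s j) g       ≈⟨ proj₂ (witness π) j ⟩
      fun (lex h j ∘ π)                 ≈⟨ fun-cong (λ l → lex-funToFin h σ (π l)) ⟩
      fun (σ ∘ π)                       ∎
      where
        g = proj₁ (witness π)
        j = funToFin σ
        enum≗σ : ∀ s → enum s j ≡ σ (index s)
        enum≗σ s = trans (enum-index s j) (lex-funToFin h σ (index s))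

    system : System 𝓜 h n
    system = record
      { ζ      = ζ
      ; compat = λ π₁ π₂ τ π₁≗τ∘π₂ → separates _ _ λ σ → begin
          minor 𝓜 σ (minor 𝓜 τ (ζ π₂))  ≈⟨ minor-∘ 𝓜 σ τ (ζ π₂) ⟨
          minor 𝓜 (σ ∘ τ) (ζ π₂)        ≈⟨ minor-ζ≈fun (σ ∘ τ) π₂ ⟩
          fun (σ ∘ τ ∘ π₂)               ≈⟨ fun-cong (λ l → cong σ (π₁≗τ∘π₂ l)) ⟨
          fun (σ ∘ π₁)                   ≈⟨ minor-ζ≈fun σ π₁ ⟨
          minor 𝓜 σ (ζ π₁)              ∎
      }

    toPol-system : ∀ b → _≈_ 𝓜 (ToPol.fun system b) (fun b)
    toPol-system b = ≈-trans (minor-ζ≈fun ρ (ι ∘ b)) (fun-cong (λ l → ρι (b l)))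

  closure≅pol : Closure 𝓜 h ≅ Pol (K r h) (Free 𝓜 enum)
  closure≅pol = record
    { hom        = toPol
    ; injective  = toPol-injective
    ; surjective = λ f → FromPol.system f , FromPol.toPol-system f
    }

theorem6p5 : (𝓜 : Minion) (r h : ℕ) → 1 ≤ r → RankAtMost 𝓜 r → r ≤ h →
    (mR : ℕ) (enum : Fin mR → Fin (r ^ h) → Fin r) → IsEnumeration (KRel r h) enum →
    Closure 𝓜 h ≅ Pol (K r h) (Free 𝓜 enum)
theorem6p5 𝓜 (suc _) h (s≤s z≤n) rank r≤h _ _ isEnum =
  ClosureAsPolymorphisms.closure≅pol 𝓜 ι clamp (λ i → clamp-inject≤ i r≤h)
    (MinionProperties.rankAtMost⇒separates 𝓜 rank (ι Fin.zero)) isEnum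
  where
    ι : Fin _ → Fin h
    ι i = inject≤ i r≤h
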